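{- For positive integers $a_1,\ldots,a_k$, in the group algebra $\mathbb{Q}[S_n]$ (products computed left to right, permutations written in deck notation), \[B_{a_1}B_{a_2} \cdots B_{a_k} = \sum_{j=\max(a_1,\ldots,a_k)}^{\min(\sum_{m=1}^k{a_m},n)}{|Q_j^{a_1,\ldots,a_k}|\,B_j}.\]
   Context: Fix $n$. For words $u=u_1\cdots u_l$ and $v=v_1\cdots v_m$, the shuffle product of $u$ and $v$ is the sum of all words of length $l+m$ in the letters $u_1,\ldots,u_l,v_1,\ldots,v_m$ in which the letters of $u$ appear in their original relative order and the letters of $v$ appear in their original relative order. $B_a\in\mathbb{Q}[S_n]$ is the shuffle product of the one-letter words $1,2,\ldots,a$ and the word $W_{a,n}=(a+1)(a+2)\cdots n$, i.e. $B_a=\sum_{\alpha\in S_a}(\text{shuffle product of }\alpha\text{ and }W_{a,n})$; it is the sum of all decks obtained by removing the top $a$ cards of the deck $12\cdots n$ and reinserting them. A deck $c_1c_2\cdots c_n$ denotes the permutation sending $c_i\mapsto i$ (deck notation), and products $\sigma\tau$ are computed left to right ($i\mapsto\tau(\sigma(i))$). $Q_j^{a_1,\ldots,a_k}$ is the set of "$(a_1,\ldots,a_k)$-segmented $j$-part partitions" of $[\sum_{m=1}^k a_m]$: partitions $\alpha=\{\alpha_1,\ldots,\alpha_j\}$ (parts ordered by their minima) built by placing $1,2,\ldots,\sum a_m$ in order into initially empty bins $\alpha_1,\ldots,\alpha_j$ such that: (1) for each $i$, the elements of the $i$th segment $[1+\sum_{m<i}a_m,\sum_{m\le i}a_m]$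 go into distinct bins, and $1,\ldots,a_1$ go into $\alpha_1,\ldots,\alpha_{a_1}$ respectively; (2) if before placing the $c$th segment ($c\ge2$) exactly $\alpha_1,\ldots,\alpha_i$ are nonempty, one chooses $l_c\in[0,\min(a_c,j-i)]$ and elements $r_1<\cdots<r_{l_c}$ of the segment, puts $r_u$ into $\alpha_{i+u}$, and puts the remaining $a_c-l_c$ elements of the segment into distinct bins among $\alpha_1,\ldots,\alpha_i$; (3) $a_1+\sum_{c=2}^k l_c=j$. Explicitly, $|Q_j^{a_1,\ldots,a_k}|=\sum_{\sum_{c=2}^k l_c=j-a_1,\ l_c\in[0,a_c]}\prod_{c=2}^k\binom{a_c}{l_c}P(a_1+\sum_{i=2}^{c-1}l_i,\,a_c-l_c)$ with $P(m,l)=\binom{m}{l}l!$. -}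

module Defs where

open import Data.Nat as ℕ using (ℕ; zero; suc; _∸_; _≤_; _!)
open import Data.Nat.Combinatorics using (_C_)
open import Data.Fin as Fin using (Fin; toℕ)
open import Data.List using (List; []; _∷_; _++_; map; concatMap; foldl; foldr; take; drop; allFin; upTo)
import Data.List.Properties as LP
open import Data.Product using (_×_; _,_)
open import Data.Integer using (+_)
open import Data.Rational using (ℚ; 0ℚ; _/_)
import Data.Rational as Q
open import Relation.Nullary using (yes; no)

shuffle : {A : Set} → List A → List A → List (List A)
shuffle []       v        = v ∷ []
shuffle (x ∷ u)  []       = (x ∷ u) ∷ []
shuffle (x ∷ u)  (y ∷ v)  = map (x ∷_) (shuffle u (y ∷ v)) ++ map (y ∷_) (shuffle (x ∷ u) v)

insertions : {A : Set} → A → List A → List (List A)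
insertions x []       = (x ∷ []) ∷ []
insertions x (y ∷ ys) = (x ∷ y ∷ ys) ∷ map (y ∷_) (insertions x ys)

-- all orderings of the letters of a word (each permutation listed once
-- when the letters are distinct)
orderings : {A : Set} → List A → List (List A)
orderings []       = [] ∷ []
orderings (x ∷ xs) = concatMap (insertions x) (orderings xs)

-- The group algebra ℚ[S_n]
-- Cards 1,…,n are represented by Fin n (card i ↦ Fin value i-1).
-- A deck c₁⋯cₙ is the word (list) of its cards.

Deck : ℕ → Set
Deck n = List (Fin n)

-- an element of ℚ[S_n] as a finite formal ℚ-linear combination of decks
QS : ℕ → Set
QS n = List (ℚ × Deck n)

at : {A : Set} → List A → ℕ → A → A
at []       _       d = d
at (x ∷ xs) zero    d = x
at (x ∷ xs) (suc i) d = at xs i d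

-- Product στ (left to right, i ↦ τ(σ(i))) in deck notation
-- (deck c sends cᵢ ↦ i): the deck of στ is  i ↦ s_{t_i}.
_∘ᵈ_ : {n : ℕ} → Deck n → Deck n → Deck n
s ∘ᵈ t = map (λ c → at s (toℕ c) c) t

δ : {n : ℕ} → Deck n → QS n
δ d = (Q.1ℚ , d) ∷ []

_⊕_ : {n : ℕ} → QS n → QS n → QS n
x ⊕ y = x ++ y

_·_ : {n : ℕ} → QS n → QS n → QS n
x · y = concatMap (λ { (p , s) → map (λ { (q , t) → (p Q.* q , s ∘ᵈ t) }) y }) x

_⊛_ : {n : ℕ} → ℕ → QS n → QS n
k ⊛ x = map (λ { (p , s) → ((+ k / 1) Q.* p , s) }) x

coeff : {n : ℕ} → QS n → Deck n → ℚ
coeff []             d = 0ℚ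
coeff ((q , s) ∷ x)  d with LP.≡-dec Fin._≟_ s d
... | yes _ = q Q.+ coeff x d
... | no  _ = coeff x d

_≈_ : {n : ℕ} → QS n → QS n → Set
x ≈ y = ∀ d → coeff x d ≡ coeff y d
  where open import Relation.Binary.PropositionalEquality using (_≡_)

Σ-QS : {n : ℕ} → List (QS n) → QS n
Σ-QS = foldr _⊕_ []

-- B_a = Σ_{α ∈ S_a} (shuffle product of α and W_{a,n}),
-- W_{a,n} = (a+1)(a+2)⋯n.

W : (a n : ℕ) → Deck n
W a n = drop a (allFin n)

B : (n a : ℕ) → QS n
B n a = Σ-QS (map (λ α → Σ-QS (map δ (shuffle α (W a n)))) (orderings (take a (allFin n))))

-- B_{a₁} B_{a₂} ⋯ B_{a_k}, with the sequence given as a₁ and [a₂,…,a_k]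
Bprod : (n : ℕ) → ℕ → List ℕ → QS n
Bprod n a₁ as = foldl (λ acc a → acc · B n a) (B n a₁) as

-- |Q_j^{a₁,…,a_k}|, via the explicit count of the choices in the
-- construction:  Σ over (l₂,…,l_k), l_c ∈ [0,a_c], a₁ + Σ l_c = j, of
-- Π_c  C(a_c,l_c) · P(a₁+l₂+⋯+l_{c-1}, a_c − l_c).

P : ℕ → ℕ → ℕ
P m l = (m C l) ℕ.* (l !)

sumℕ : List ℕ → ℕ
sumℕ = foldr ℕ._+_ 0

-- cnt m j [a_c,…,a_k]: m = number of nonempty bins before segment c
cnt : ℕ → ℕ → List ℕ → ℕ
cnt m j []       with m ℕ.≟ j
... | yes _ = 1
... | no  _ = 0
cnt m j (a ∷ as) = sumℕ (map (λ l → (a C l) ℕ.* P m (a ∸ l) ℕ.* cnt (m ℕ.+ l) j as) (upTo (suc a)))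

Qcard : (j a₁ : ℕ) → List ℕ → ℕ
Qcard j a₁ as = cnt a₁ j as

range : ℕ → ℕ → List ℕ
range lo hi = map (lo ℕ.+_) (upTo (suc hi ∸ lo))

maxL : List ℕ → ℕ
maxL = foldr ℕ._⊔_ 0

-- B_a is the multiset of decks obtained from 1 2 ⋯ n by taking off the top a cards and inserting
-- them back one at a time, and in deck notation right multiplication of a deck s by B_b performs the
-- same operation on s. Reinserting the top b cards of a deck in which the top a cards were already
-- reinserted amounts to reinserting the top a + l cards, where l of the b cards had not been moved
-- before; counting the ways gives B_a B_b = Σ_l C(b,l) P(a,b−l) B_{a+l}, which is checked by a double
-- induction on a and b resting on Pascal's rule. Expanding the factors of B_{a₁} ⋯ B_{a_k} one at a
-- time therefore produces exactly the recursion defining |Q_j|, and the terms with j outside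
-- [max a_i, min(Σ a_i, n)] vanish. Multisets of decks are compared as lists up to permutation, or
-- through their weighted counts Σ_{s} g(s) when multiplicities are involved.

module Submission where

open import Defs
open import Data.Nat using (ℕ; zero; suc; _+_; _*_; _∸_; _≤_; _<_; _⊓_; _!; z≤n; s≤s; _≟_; _≤?_)
open import Data.Nat.Properties
open import Data.Nat.Combinatorics using (_C_; nCk+nC[k+1]≡[n+1]C[k+1]; nCk≡nC[n∸k]; nC1≡n; nCn≡1; k>n⇒nCk≡0)
open import Data.Nat.Coprimality using (1-coprimeTo) renaming (sym to Coprime-sym)
open import Data.Nat.ListAction.Properties using (sum-++; sum-↭)
open import Data.Nat.Tactic.RingSolver using (solve-∀)
import Data.Integer as ℤ
import Data.Integer.Properties as ℤₚ
open import Data.Rational as ℚ using (ℚ; mkℚ; 1ℚ; _/_)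
import Data.Rational.Properties as ℚₚ
open import Data.Fin as Fin using (Fin; toℕ)
open import Data.Product using (_×_; _,_; proj₂)
open import Data.Sum using (_⊎_; inj₁; inj₂)
open import Data.List using (List; []; _∷_; _++_; map; concatMap; foldl; upTo; length; take; drop; allFin; tabulate)
open import Data.List.Properties
  using ( ≡-dec; map-++; map-∘; map-cong; map-cong-local; map-tabulate; length-tabulate; length-take
        ; concatMap-++; concatMap-map; map-concatMap; concatMap-cong; concatMap-pure
        ; ++-assoc; ++-identityʳ; upTo-∷ʳ; take++drop≡id )
open import Data.List.Relation.Unary.All as All using (All; []; _∷_)
import Data.List.Relation.Unary.All.Properties as All
open import Data.List.Relation.Binary.Permutation.Propositional as Perm
  using (_↭_; ↭-refl; ↭-sym; ↭-trans; ↭-reflexive; ↭-prep; ↭-swap; module PermutationReasoning)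
import Data.List.Relation.Binary.Permutation.Propositional.Properties as ↭
open import Algebra.Bundles using (CommutativeMonoid)
import Algebra.Properties.CommutativeSemigroup as CommSemigroupProperties
open import Relation.Binary.PropositionalEquality
open import Relation.Nullary using (yes; no; contradiction)

open CommSemigroupProperties +-commutativeSemigroup using () renaming (interchange to +-interchange)

-- Weighted counts

sumOf : {A : Set} → (A → ℕ) → List A → ℕ
sumOf g xs = sumℕ (map g xs)

module _ {A : Set} where

  sumOf-++ : ∀ (g : A → ℕ) xs ys → sumOf g (xs ++ ys) ≡ sumOf g xs + sumOf g ys
  sumOf-++ g xs ys = trans (cong sumℕ (map-++ g xs ys)) (sum-++ (map g xs) (map g ys))

  sumOf-↭ : ∀ (g : A → ℕ) {xs ys} → xs ↭ ys → sumOf g xs ≡ sumOf g ys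
  sumOf-↭ g p = sum-↭ (↭.map⁺ g p)

  sumOf-cong : ∀ {g h : A → ℕ} xs → (∀ x → g x ≡ h x) → sumOf g xs ≡ sumOf h xs
  sumOf-cong xs g≗h = cong sumℕ (map-cong g≗h xs)

  sumOf-cong-All : ∀ {g h : A → ℕ} {xs} → All (λ x → g x ≡ h x) xs → sumOf g xs ≡ sumOf h xs
  sumOf-cong-All g≗h = cong sumℕ (map-cong-local g≗h)

  sumOf-zero : ∀ {g : A → ℕ} xs → (∀ x → g x ≡ 0) → sumOf g xs ≡ 0
  sumOf-zero []       _   = refl
  sumOf-zero (x ∷ xs) g≡0 = cong₂ _+_ (g≡0 x) (sumOf-zero xs g≡0)

  sumOf-+ : ∀ (g h : A → ℕ) xs → sumOf (λ x → g x + h x) xs ≡ sumOf g xs + sumOf h xs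
  sumOf-+ g h []       = refl
  sumOf-+ g h (x ∷ xs) = begin
    g x + h x + sumOf (λ x → g x + h x) xs   ≡⟨ cong (g x + h x +_) (sumOf-+ g h xs) ⟩
    g x + h x + (sumOf g xs + sumOf h xs)   ≡⟨ +-interchange (g x) (h x) _ _ ⟩
    g x + sumOf g xs + (h x + sumOf h xs)   ∎
    where open ≡-Reasoning

  sumOf-*ˡ : ∀ k (g : A → ℕ) xs → sumOf (λ x → k * g x) xs ≡ k * sumOf g xs
  sumOf-*ˡ k g []       = sym (*-zeroʳ k)
  sumOf-*ˡ k g (x ∷ xs) =
    trans (cong (k * g x +_) (sumOf-*ˡ k g xs)) (sym (*-distribˡ-+ k (g x) (sumOf g xs)))

  sumOf-*ʳ : ∀ k (g : A → ℕ) xs → sumOf (λ x → g x * k) xs ≡ sumOf g xs * k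
  sumOf-*ʳ k g xs =
    trans (sumOf-cong xs (λ x → *-comm (g x) k)) (trans (sumOf-*ˡ k g xs) (*-comm k (sumOf g xs)))

module _ {A B : Set} where

  sumOf-map : ∀ (g : B → ℕ) (f : A → B) xs → sumOf g (map f xs) ≡ sumOf (λ x → g (f x)) xs
  sumOf-map g f xs = cong sumℕ (sym (map-∘ xs))

  sumOf-concatMap : ∀ (g : B → ℕ) (f : A → List B) xs →
                    sumOf g (concatMap f xs) ≡ sumOf (λ x → sumOf g (f x)) xs
  sumOf-concatMap g f []       = refl
  sumOf-concatMap g f (x ∷ xs) =
    trans (sumOf-++ g (f x) (concatMap f xs)) (cong (sumOf g (f x) +_) (sumOf-concatMap g f xs))

  sumOf-swap : ∀ (f : A → B → ℕ) xs ys →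
               sumOf (λ x → sumOf (f x) ys) xs ≡ sumOf (λ y → sumOf (λ x → f x y) xs) ys
  sumOf-swap f []       ys = sym (sumOf-zero ys (λ _ → refl))
  sumOf-swap f (x ∷ xs) ys =
    trans (cong (sumOf (f x) ys +_) (sumOf-swap f xs ys)) (sym (sumOf-+ (f x) _ ys))

sumOf-*-sumOf-comm : ∀ {A B : Set} (c : A → ℕ) (d : A → B → ℕ) (t : B → ℕ) xs ys →
  sumOf (λ x → c x * sumOf (λ y → d x y * t y) ys) xs ≡ sumOf (λ y → sumOf (λ x → c x * d x y) xs * t y) ys
sumOf-*-sumOf-comm c d t xs ys = begin
  sumOf (λ x → c x * sumOf (λ y → d x y * t y) ys) xs
    ≡⟨ sumOf-cong xs (λ x → sumOf-*ˡ (c x) (λ y → d x y * t y) ys) ⟨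
  sumOf (λ x → sumOf (λ y → c x * (d x y * t y)) ys) xs
    ≡⟨ sumOf-swap (λ x y → c x * (d x y * t y)) xs ys ⟩
  sumOf (λ y → sumOf (λ x → c x * (d x y * t y)) xs) ys
    ≡⟨ sumOf-cong ys (λ y → trans (sumOf-cong xs (λ x → sym (*-assoc (c x) (d x y) (t y))))
                                  (sumOf-*ʳ (t y) (λ x → c x * d x y) xs)) ⟩
  sumOf (λ y → sumOf (λ x → c x * d x y) xs * t y) ys  ∎
  where open ≡-Reasoning

sumOf-upTo-suc : ∀ (g : ℕ → ℕ) n → sumOf g (upTo (suc n)) ≡ sumOf g (upTo n) + g n
sumOf-upTo-suc g n = begin
  sumOf g (upTo (suc n))         ≡⟨ cong (sumOf g) (upTo-∷ʳ n) ⟨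
  sumOf g (upTo n ++ n ∷ [])     ≡⟨ sumOf-++ g (upTo n) (n ∷ []) ⟩
  sumOf g (upTo n) + (g n + 0)   ≡⟨ cong (sumOf g (upTo n) +_) (+-identityʳ (g n)) ⟩
  sumOf g (upTo n) + g n         ∎
  where open ≡-Reasoning

sumOf-cong-upTo : ∀ {g h : ℕ → ℕ} n → (∀ l → l < n → g l ≡ h l) → sumOf g (upTo n) ≡ sumOf h (upTo n)
sumOf-cong-upTo n g≗h = sumOf-cong-All (All.applyUpTo⁺₁ (λ l → l) n (g≗h _))

sumOf-zero-upTo : ∀ {g : ℕ → ℕ} n → (∀ l → l < n → g l ≡ 0) → sumOf g (upTo n) ≡ 0
sumOf-zero-upTo n g≡0 = trans (sumOf-cong-upTo n g≡0) (sumOf-zero (upTo n) (λ _ → refl))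

sumOf-upTo-+ : ∀ (g : ℕ → ℕ) m k →
               sumOf g (upTo (m + k)) ≡ sumOf g (upTo m) + sumOf (λ i → g (m + i)) (upTo k)
sumOf-upTo-+ g m zero    = trans (cong (λ z → sumOf g (upTo z)) (+-identityʳ m)) (sym (+-identityʳ _))
sumOf-upTo-+ g m (suc k) = begin
  sumOf g (upTo (m + suc k))                                  ≡⟨ cong (λ z → sumOf g (upTo z)) (+-suc m k) ⟩
  sumOf g (upTo (suc (m + k)))                                ≡⟨ sumOf-upTo-suc g (m + k) ⟩
  sumOf g (upTo (m + k)) + g (m + k)                          ≡⟨ cong (_+ g (m + k)) (sumOf-upTo-+ g m k) ⟩
  sumOf g (upTo m) + sumOf g′ (upTo k) + g′ k                 ≡⟨ +-assoc (sumOf g (upTo m)) _ _ ⟩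
  sumOf g (upTo m) + (sumOf g′ (upTo k) + g′ k)               ≡⟨ cong (sumOf g (upTo m) +_) (sumOf-upTo-suc g′ k) ⟨
  sumOf g (upTo m) + sumOf g′ (upTo (suc k))                  ∎
  where
  open ≡-Reasoning
  g′ = λ i → g (m + i)

sumOf-upTo-range : ∀ (g : ℕ → ℕ) N lo hi → lo ≤ hi → hi < N →
                   (∀ j → j < lo → g j ≡ 0) → (∀ j → hi < j → g j ≡ 0) →
                   sumOf g (upTo N) ≡ sumOf g (range lo hi)
sumOf-upTo-range g N lo hi lo≤hi hi<N below above = begin
  sumOf g (upTo N)                                          ≡⟨ cong (λ z → sumOf g (upTo z)) lo+k+r≡N ⟨
  sumOf g (upTo (lo + (k + r)))                             ≡⟨ sumOf-upTo-+ g lo (k + r) ⟩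
  sumOf g (upTo lo) + sumOf g′ (upTo (k + r))               ≡⟨ cong₂ _+_ (sumOf-zero-upTo lo below) (sumOf-upTo-+ g′ k r) ⟩
  sumOf g′ (upTo k) + sumOf (λ i → g′ (k + i)) (upTo r)     ≡⟨ cong (sumOf g′ (upTo k) +_) (sumOf-zero (upTo r) (λ i → above _ (hi<lo+[k+i] i))) ⟩
  sumOf g′ (upTo k) + 0                                     ≡⟨ +-identityʳ _ ⟩
  sumOf g′ (upTo k)                                         ≡⟨ sumOf-map g (lo +_) (upTo k) ⟨
  sumOf g (range lo hi)                                     ∎
  where
  open ≡-Reasoning
  g′ = λ i → g (lo + i)
  k = suc hi ∸ lo
  r = N ∸ suc hi
  lo+k≡1+hi : lo + k ≡ suc hi
  lo+k≡1+hi = m+[n∸m]≡n (m≤n⇒m≤1+n lo≤hi)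
  lo+k+r≡N : lo + (k + r) ≡ N
  lo+k+r≡N = trans (sym (+-assoc lo k r)) (trans (cong (_+ r) lo+k≡1+hi) (m+[n∸m]≡n hi<N))
  hi<lo+[k+i] : ∀ i → hi < lo + (k + i)
  hi<lo+[k+i] i = ≤-trans (≤-reflexive (sym lo+k≡1+hi)) (≤-trans (m≤m+n (lo + k) i) (≤-reflexive (+-assoc lo k i)))

sumOf-cong-range : ∀ {g h : ℕ → ℕ} lo hi → lo ≤ hi → (∀ j → j ≤ hi → g j ≡ h j) →
                   sumOf g (range lo hi) ≡ sumOf h (range lo hi)
sumOf-cong-range {g} {h} lo hi lo≤hi g≗h = begin
  sumOf g (map (lo +_) (upTo (suc hi ∸ lo)))      ≡⟨ sumOf-map g (lo +_) (upTo (suc hi ∸ lo)) ⟩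
  sumOf (λ i → g (lo + i)) (upTo (suc hi ∸ lo))   ≡⟨ sumOf-cong-upTo (suc hi ∸ lo) (λ i i< → g≗h (lo + i) (lo+i≤hi i<)) ⟩
  sumOf (λ i → h (lo + i)) (upTo (suc hi ∸ lo))   ≡⟨ sumOf-map h (lo +_) (upTo (suc hi ∸ lo)) ⟨
  sumOf h (map (lo +_) (upTo (suc hi ∸ lo)))      ∎
  where
  open ≡-Reasoning
  lo+i≤hi : ∀ {i} → i < suc hi ∸ lo → lo + i ≤ hi
  lo+i≤hi {i} i< = ≤-pred (subst (lo + i <_) (m+[n∸m]≡n (m≤n⇒m≤1+n lo≤hi)) (+-monoʳ-< lo i<))

module _ {A : Set} where
  open CommSemigroupProperties (CommutativeMonoid.commutativeSemigroup (↭.++-commutativeMonoid {A = A}))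
    using () renaming (interchange to ++-interchange) public

module _ {A B : Set} where

  concatMap-↭ : ∀ {f g : A → List B} {xs} → All (λ x → f x ↭ g x) xs → concatMap f xs ↭ concatMap g xs
  concatMap-↭ []           = ↭-refl
  concatMap-↭ (fx↭gx ∷ p) = ↭.++⁺ fx↭gx (concatMap-↭ p)

  concatMap⁺ : ∀ (f : A → List B) {xs ys} → xs ↭ ys → concatMap f xs ↭ concatMap f ys
  concatMap⁺ f Perm.refl          = ↭-refl
  concatMap⁺ f (Perm.prep x p)    = ↭.++⁺ˡ (f x) (concatMap⁺ f p)
  concatMap⁺ f (Perm.swap x y p)  = ↭-trans (↭.shifts (f x) (f y)) (↭.++⁺ˡ (f y) (↭.++⁺ˡ (f x) (concatMap⁺ f p)))
  concatMap⁺ f (Perm.trans p q)   = ↭-trans (concatMap⁺ f p) (concatMap⁺ f q)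

  concatMap-++-distrib : ∀ (f g : A → List B) xs →
                         concatMap (λ x → f x ++ g x) xs ↭ concatMap f xs ++ concatMap g xs
  concatMap-++-distrib f g []       = ↭-refl
  concatMap-++-distrib f g (x ∷ xs) = begin
    (f x ++ g x) ++ concatMap (λ x → f x ++ g x) xs      ↭⟨ ↭.++⁺ˡ (f x ++ g x) (concatMap-++-distrib f g xs) ⟩
    (f x ++ g x) ++ (concatMap f xs ++ concatMap g xs)   ↭⟨ ++-interchange (f x) (g x) _ _ ⟩
    (f x ++ concatMap f xs) ++ (g x ++ concatMap g xs)   ∎
    where open PermutationReasoning

  concatMap-concatMap : ∀ {C : Set} (f : B → List C) (g : A → List B) xs →
                        concatMap f (concatMap g xs) ≡ concatMap (λ x → concatMap f (g x)) xs
  concatMap-concatMap f g []       = refl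
  concatMap-concatMap f g (x ∷ xs) =
    trans (concatMap-++ f (g x) (concatMap g xs)) (cong (concatMap f (g x) ++_) (concatMap-concatMap f g xs))

-- Reinserting the top letters of a word

module _ {A : Set} where

  insertEach : A → List (List A) → List (List A)
  insertEach x = concatMap (insertions x)

  -- Take off the top a letters of w and insert them back one at a time, bottom-most first;
  -- B_a is the multiset reinsert a (1 2 ⋯ n) for a ≤ n, while reinsert a w = [] when w is shorter than a.
  reinsert : ℕ → List A → List (List A)
  reinsert zero    w       = w ∷ []
  reinsert (suc a) []      = []
  reinsert (suc a) (x ∷ w) = insertEach x (reinsert a w)

  insertEach-map-∷ : ∀ a c V → insertEach a (map (c ∷_) V) ↭ map (λ v → a ∷ c ∷ v) V ++ map (c ∷_) (insertEach a V)
  insertEach-map-∷ a c []      = ↭-refl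
  insertEach-map-∷ a c (v ∷ V) = ↭-prep (a ∷ c ∷ v) (begin
    map (c ∷_) (insertions a v) ++ insertEach a (map (c ∷_) V)
      ↭⟨ ↭.++⁺ˡ _ (insertEach-map-∷ a c V) ⟩
    map (c ∷_) (insertions a v) ++ (map (λ v → a ∷ c ∷ v) V ++ map (c ∷_) (insertEach a V))
      ↭⟨ ↭.shifts (map (c ∷_) (insertions a v)) (map (λ v → a ∷ c ∷ v) V) ⟩
    map (λ v → a ∷ c ∷ v) V ++ (map (c ∷_) (insertions a v) ++ map (c ∷_) (insertEach a V))
      ≡⟨ cong (map (λ v → a ∷ c ∷ v) V ++_) (map-++ (c ∷_) (insertions a v) (insertEach a V)) ⟨
    map (λ v → a ∷ c ∷ v) V ++ map (c ∷_) (insertEach a (v ∷ V))  ∎)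
    where open PermutationReasoning

  insertEach-insertions-∷ : ∀ a b c u →
    insertEach a (insertions b (c ∷ u)) ↭
      (a ∷ b ∷ c ∷ u) ∷ (b ∷ a ∷ c ∷ u) ∷
        (map (λ v → b ∷ c ∷ v) (insertions a u) ++ map (λ v → a ∷ c ∷ v) (insertions b u)
          ++ map (c ∷_) (insertEach a (insertions b u)))
  insertEach-insertions-∷ a b c u = ↭-prep _ (↭-prep _ (begin
    map (b ∷_) (map (c ∷_) (insertions a u)) ++ insertEach a (map (c ∷_) (insertions b u))
      ≡⟨ cong (_++ insertEach a (map (c ∷_) (insertions b u))) (map-∘ (insertions a u)) ⟨
    map (λ v → b ∷ c ∷ v) (insertions a u) ++ insertEach a (map (c ∷_) (insertions b u))
      ↭⟨ ↭.++⁺ˡ _ (insertEach-map-∷ a c (insertions b u)) ⟩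
    map (λ v → b ∷ c ∷ v) (insertions a u) ++ map (λ v → a ∷ c ∷ v) (insertions b u)
      ++ map (c ∷_) (insertEach a (insertions b u))  ∎))
    where open PermutationReasoning

  insertEach-insertions-comm : ∀ a b u → insertEach a (insertions b u) ↭ insertEach b (insertions a u)
  insertEach-insertions-comm a b []      = ↭-swap _ _ ↭-refl
  insertEach-insertions-comm a b (c ∷ u) = begin
    insertEach a (insertions b (c ∷ u))
      ↭⟨ insertEach-insertions-∷ a b c u ⟩
    (a ∷ b ∷ c ∷ u) ∷ (b ∷ a ∷ c ∷ u) ∷ (Xa ++ Xb ++ map (c ∷_) (insertEach a (insertions b u)))
      ↭⟨ ↭-swap _ _ (↭.shifts Xa Xb) ⟩
    (b ∷ a ∷ c ∷ u) ∷ (a ∷ b ∷ c ∷ u) ∷ (Xb ++ Xa ++ map (c ∷_) (insertEach a (insertions b u)))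
      ↭⟨ ↭-prep _ (↭-prep _ (↭.++⁺ˡ Xb (↭.++⁺ˡ Xa (↭.map⁺ (c ∷_) (insertEach-insertions-comm a b u))))) ⟩
    (b ∷ a ∷ c ∷ u) ∷ (a ∷ b ∷ c ∷ u) ∷ (Xb ++ Xa ++ map (c ∷_) (insertEach b (insertions a u)))
      ↭⟨ insertEach-insertions-∷ b a c u ⟨
    insertEach b (insertions a (c ∷ u))  ∎
    where
    open PermutationReasoning
    Xa = map (λ v → b ∷ c ∷ v) (insertions a u)
    Xb = map (λ v → a ∷ c ∷ v) (insertions b u)

  insertEach-comm : ∀ a b U → insertEach a (insertEach b U) ↭ insertEach b (insertEach a U)
  insertEach-comm a b []      = ↭-refl
  insertEach-comm a b (u ∷ U) = begin
    insertEach a (insertions b u ++ insertEach b U)              ≡⟨ concatMap-++ (insertions a) (insertions b u) _ ⟩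
    insertEach a (insertions b u) ++ insertEach a (insertEach b U)
      ↭⟨ ↭.++⁺ (insertEach-insertions-comm a b u) (insertEach-comm a b U) ⟩
    insertEach b (insertions a u) ++ insertEach b (insertEach a U) ≡⟨ concatMap-++ (insertions b) (insertions a u) _ ⟨
    insertEach b (insertions a u ++ insertEach a U)              ∎
    where open PermutationReasoning

  shuffle-[]ʳ : ∀ (α : List A) → shuffle α [] ≡ α ∷ []
  shuffle-[]ʳ []      = refl
  shuffle-[]ʳ (x ∷ α) = refl

  shuffle-singleton : ∀ (x : A) r → shuffle (x ∷ []) r ≡ insertions x r
  shuffle-singleton x []      = refl
  shuffle-singleton x (y ∷ r) = cong ((x ∷ y ∷ r) ∷_) (cong (map (y ∷_)) (shuffle-singleton x r))

  shuffle-insertions-∷∷ : ∀ x b β y (r : List A) →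
    concatMap (λ α → shuffle α (y ∷ r)) (insertions x (b ∷ β)) ↭
      (map (x ∷_) (shuffle (b ∷ β) (y ∷ r)) ++ map (b ∷_) (concatMap (λ α → shuffle α (y ∷ r)) (insertions x β)))
        ++ map (y ∷_) (concatMap (λ α → shuffle α r) (insertions x (b ∷ β)))
  shuffle-insertions-∷∷ x b β y r = begin
    (Mx ++ map (y ∷_) (shuffle (x ∷ b ∷ β) r)) ++ concatMap (λ α → shuffle α (y ∷ r)) (map (b ∷_) L)
      ≡⟨ cong ((Mx ++ map (y ∷_) (shuffle (x ∷ b ∷ β) r)) ++_) (concatMap-map (λ α → shuffle α (y ∷ r)) (b ∷_) L) ⟩
    (Mx ++ map (y ∷_) (shuffle (x ∷ b ∷ β) r)) ++ concatMap (λ α → map (b ∷_) (shuffle α (y ∷ r)) ++ map (y ∷_) (shuffle (b ∷ α) r)) L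
      ↭⟨ ↭.++⁺ˡ _ (concatMap-++-distrib _ _ L) ⟩
    (Mx ++ map (y ∷_) (shuffle (x ∷ b ∷ β) r)) ++ (concatMap (λ α → map (b ∷_) (shuffle α (y ∷ r))) L ++ concatMap (λ α → map (y ∷_) (shuffle (b ∷ α) r)) L)
      ↭⟨ ++-interchange Mx _ _ _ ⟩
    (Mx ++ concatMap (λ α → map (b ∷_) (shuffle α (y ∷ r))) L) ++ (map (y ∷_) (shuffle (x ∷ b ∷ β) r) ++ concatMap (λ α → map (y ∷_) (shuffle (b ∷ α) r)) L)
      ≡⟨ cong₂ (λ P Q → (Mx ++ P) ++ (map (y ∷_) (shuffle (x ∷ b ∷ β) r) ++ Q))
               (map-concatMap (b ∷_) (λ α → shuffle α (y ∷ r)) L) (map-concatMap (y ∷_) (λ α → shuffle (b ∷ α) r) L) ⟨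
    (Mx ++ map (b ∷_) (concatMap (λ α → shuffle α (y ∷ r)) L)) ++ (map (y ∷_) (shuffle (x ∷ b ∷ β) r) ++ map (y ∷_) (concatMap (λ α → shuffle (b ∷ α) r) L))
      ≡⟨ cong ((Mx ++ map (b ∷_) (concatMap (λ α → shuffle α (y ∷ r)) L)) ++_) y-first ⟩
    (Mx ++ map (b ∷_) (concatMap (λ α → shuffle α (y ∷ r)) L)) ++ map (y ∷_) (concatMap (λ α → shuffle α r) (insertions x (b ∷ β)))  ∎
    where
    open PermutationReasoning
    L  = insertions x β
    Mx = map (x ∷_) (shuffle (b ∷ β) (y ∷ r))
    y-first : map (y ∷_) (shuffle (x ∷ b ∷ β) r) ++ map (y ∷_) (concatMap (λ α → shuffle (b ∷ α) r) L)
              ≡ map (y ∷_) (concatMap (λ α → shuffle α r) (insertions x (b ∷ β)))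
    y-first = trans (sym (map-++ (y ∷_) (shuffle (x ∷ b ∷ β) r) _))
                    (cong (λ Q → map (y ∷_) (shuffle (x ∷ b ∷ β) r ++ Q)) (sym (concatMap-map (λ α → shuffle α r) (b ∷_) L)))

  insertEach-shuffle-∷∷ : ∀ x b β y (r : List A) →
    insertEach x (shuffle (b ∷ β) (y ∷ r)) ↭
      (map (x ∷_) (shuffle (b ∷ β) (y ∷ r)) ++ map (b ∷_) (insertEach x (shuffle β (y ∷ r))))
        ++ map (y ∷_) (insertEach x (shuffle (b ∷ β) r))
  insertEach-shuffle-∷∷ x b β y r = begin
    insertEach x (map (b ∷_) V₁ ++ map (y ∷_) V₂)
      ≡⟨ concatMap-++ (insertions x) (map (b ∷_) V₁) (map (y ∷_) V₂) ⟩
    insertEach x (map (b ∷_) V₁) ++ insertEach x (map (y ∷_) V₂)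
      ↭⟨ ↭.++⁺ (insertEach-map-∷ x b V₁) (insertEach-map-∷ x y V₂) ⟩
    (map (λ v → x ∷ b ∷ v) V₁ ++ map (b ∷_) (insertEach x V₁)) ++ (map (λ v → x ∷ y ∷ v) V₂ ++ map (y ∷_) (insertEach x V₂))
      ↭⟨ ++-interchange (map (λ v → x ∷ b ∷ v) V₁) _ _ _ ⟩
    (map (λ v → x ∷ b ∷ v) V₁ ++ map (λ v → x ∷ y ∷ v) V₂) ++ (map (b ∷_) (insertEach x V₁) ++ map (y ∷_) (insertEach x V₂))
      ≡⟨ ++-assoc (map (λ v → x ∷ b ∷ v) V₁ ++ map (λ v → x ∷ y ∷ v) V₂) _ _ ⟨
    ((map (λ v → x ∷ b ∷ v) V₁ ++ map (λ v → x ∷ y ∷ v) V₂) ++ map (b ∷_) (insertEach x V₁)) ++ map (y ∷_) (insertEach x V₂)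
      ≡⟨ cong (λ M → (M ++ map (b ∷_) (insertEach x V₁)) ++ map (y ∷_) (insertEach x V₂)) x-first ⟩
    (map (x ∷_) (shuffle (b ∷ β) (y ∷ r)) ++ map (b ∷_) (insertEach x V₁)) ++ map (y ∷_) (insertEach x V₂)  ∎
    where
    open PermutationReasoning
    V₁ = shuffle β (y ∷ r)
    V₂ = shuffle (b ∷ β) r
    x-first : map (λ v → x ∷ b ∷ v) V₁ ++ map (λ v → x ∷ y ∷ v) V₂ ≡ map (x ∷_) (shuffle (b ∷ β) (y ∷ r))
    x-first = trans (cong₂ _++_ (map-∘ V₁) (map-∘ V₂)) (sym (map-++ (x ∷_) (map (b ∷_) V₁) (map (y ∷_) V₂)))

  shuffle-insertions : ∀ x β r → concatMap (λ α → shuffle α r) (insertions x β) ↭ insertEach x (shuffle β r)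
  shuffle-insertions x []      r = ↭-reflexive (cong (_++ []) (shuffle-singleton x r))
  shuffle-insertions x (b ∷ β) [] = ↭-reflexive (begin
    concatMap (λ α → shuffle α []) (insertions x (b ∷ β)) ≡⟨ concatMap-cong shuffle-[]ʳ (insertions x (b ∷ β)) ⟩
    concatMap (_∷ []) (insertions x (b ∷ β))               ≡⟨ concatMap-pure (insertions x (b ∷ β)) ⟩
    insertions x (b ∷ β)                                   ≡⟨ ++-identityʳ (insertions x (b ∷ β)) ⟨
    insertEach x (shuffle (b ∷ β) [])                     ∎)
    where open ≡-Reasoning
  shuffle-insertions x (b ∷ β) (y ∷ r) = begin
    concatMap (λ α → shuffle α (y ∷ r)) (insertions x (b ∷ β))
      ↭⟨ shuffle-insertions-∷∷ x b β y r ⟩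
    (Mx ++ map (b ∷_) (concatMap (λ α → shuffle α (y ∷ r)) (insertions x β)))
      ++ map (y ∷_) (concatMap (λ α → shuffle α r) (insertions x (b ∷ β)))
      ↭⟨ ↭.++⁺ (↭.++⁺ˡ Mx (↭.map⁺ (b ∷_) (shuffle-insertions x β (y ∷ r))))
               (↭.map⁺ (y ∷_) (shuffle-insertions x (b ∷ β) r)) ⟩
    (Mx ++ map (b ∷_) (insertEach x (shuffle β (y ∷ r)))) ++ map (y ∷_) (insertEach x (shuffle (b ∷ β) r))
      ↭⟨ insertEach-shuffle-∷∷ x b β y r ⟨
    insertEach x (shuffle (b ∷ β) (y ∷ r))  ∎
    where
    open PermutationReasoning
    Mx = map (x ∷_) (shuffle (b ∷ β) (y ∷ r))

  orderings-shuffle : ∀ p r → concatMap (λ α → shuffle α r) (orderings p) ↭ reinsert (length p) (p ++ r)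
  orderings-shuffle []      r = ↭-refl
  orderings-shuffle (x ∷ p) r = begin
    concatMap (λ α → shuffle α r) (insertEach x (orderings p))
      ≡⟨ concatMap-concatMap (λ α → shuffle α r) (insertions x) (orderings p) ⟩
    concatMap (λ β → concatMap (λ α → shuffle α r) (insertions x β)) (orderings p)
      ↭⟨ concatMap-↭ (All.universal (λ β → shuffle-insertions x β r) (orderings p)) ⟩
    concatMap (λ β → insertEach x (shuffle β r)) (orderings p)
      ≡⟨ concatMap-concatMap (insertions x) (λ β → shuffle β r) (orderings p) ⟨
    insertEach x (concatMap (λ β → shuffle β r) (orderings p))
      ↭⟨ concatMap⁺ (insertions x) (orderings-shuffle p r) ⟩
    insertEach x (reinsert (length p) (p ++ r))  ∎
    where open PermutationReasoning

  orderings-shuffle-take-drop : ∀ j w → j ≤ length w →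
    concatMap (λ α → shuffle α (drop j w)) (orderings (take j w)) ↭ reinsert j w
  orderings-shuffle-take-drop j w j≤∣w∣ =
    ↭-trans (orderings-shuffle (take j w) (drop j w))
            (↭-reflexive (cong₂ reinsert (trans (length-take j w) (m≤n⇒m⊓n≡m j≤∣w∣)) (take++drop≡id j w)))

  reinsert-tooShort : ∀ m w → length w < m → reinsert m w ≡ []
  reinsert-tooShort (suc m) []      _              = refl
  reinsert-tooShort (suc m) (x ∷ w) (s≤s ∣w∣<m) rewrite reinsert-tooShort m w ∣w∣<m = refl

  insertions-length : ∀ (x : A) u → All (λ v → length v ≡ suc (length u)) (insertions x u)
  insertions-length x []      = refl ∷ []
  insertions-length x (y ∷ u) = refl ∷ All.map⁺ (All.map (cong suc) (insertions-length x u))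

  reinsert-length : ∀ a (w : List A) → All (λ v → length v ≡ length w) (reinsert a w)
  reinsert-length zero    w       = refl ∷ []
  reinsert-length (suc a) []      = []
  reinsert-length (suc a) (x ∷ w) =
    All.concat⁺ (All.map⁺ (All.map (λ {v} ∣v∣≡∣w∣ → All.map (λ e → trans e (cong suc ∣v∣≡∣w∣)) (insertions-length x v))
                                   (reinsert-length a w)))

module _ {A B : Set} (f : A → B) where

  map-insertions : ∀ x ys → map (map f) (insertions x ys) ≡ insertions (f x) (map f ys)
  map-insertions x []       = refl
  map-insertions x (y ∷ ys) = cong ((f x ∷ f y ∷ map f ys) ∷_) (begin
    map (map f) (map (y ∷_) (insertions x ys))   ≡⟨ map-∘ (insertions x ys) ⟨
    map (λ v → f y ∷ map f v) (insertions x ys)  ≡⟨ map-∘ (insertions x ys) ⟩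
    map (f y ∷_) (map (map f) (insertions x ys)) ≡⟨ cong (map (f y ∷_)) (map-insertions x ys) ⟩
    map (f y ∷_) (insertions (f x) (map f ys))   ∎)
    where open ≡-Reasoning

  map-insertEach : ∀ x U → map (map f) (insertEach x U) ≡ insertEach (f x) (map (map f) U)
  map-insertEach x U = begin
    map (map f) (insertEach x U)                 ≡⟨ map-concatMap (map f) (insertions x) U ⟩
    concatMap (λ u → map (map f) (insertions x u)) U ≡⟨ concatMap-cong (map-insertions x) U ⟩
    concatMap (λ u → insertions (f x) (map f u)) U   ≡⟨ concatMap-map (insertions (f x)) (map f) U ⟨
    insertEach (f x) (map (map f) U)             ∎
    where open ≡-Reasoning

  map-reinsert : ∀ a w → map (map f) (reinsert a w) ≡ reinsert a (map f w)
  map-reinsert zero    w       = refl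
  map-reinsert (suc a) []      = refl
  map-reinsert (suc a) (x ∷ w) = trans (map-insertEach x (reinsert a w)) (cong (insertEach (f x)) (map-reinsert a w))

-- Binomial coefficients and partial permutations

C-absorption : ∀ n k → suc k * (suc n C suc k) ≡ suc n * (n C k)
C-absorption zero    zero    = refl
C-absorption zero    (suc k) = trans (cong (suc (suc k) *_) (k>n⇒nCk≡0 {1} (s≤s (s≤s (z≤n {k}))))) (*-zeroʳ (suc (suc k)))
C-absorption (suc n) zero    = trans (*-identityˡ _) (trans (nC1≡n (suc (suc n))) (sym (*-identityʳ _)))
C-absorption (suc n) (suc k) = begin
  suc (suc k) * (suc (suc n) C suc (suc k))
    ≡⟨ cong (suc (suc k) *_) (nCk+nC[k+1]≡[n+1]C[k+1] (suc n) (suc k)) ⟨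
  suc (suc k) * (suc n C suc k + suc n C suc (suc k))
    ≡⟨ regroup (suc n C suc k) (suc n C suc (suc k)) k ⟩
  suc n C suc k + suc k * (suc n C suc k) + suc (suc k) * (suc n C suc (suc k))
    ≡⟨ cong₂ (λ p q → suc n C suc k + p + q) (C-absorption n k) (C-absorption n (suc k)) ⟩
  suc n C suc k + suc n * (n C k) + suc n * (n C suc k)
    ≡⟨ +-assoc (suc n C suc k) _ _ ⟩
  suc n C suc k + (suc n * (n C k) + suc n * (n C suc k))
    ≡⟨ cong (suc n C suc k +_) (*-distribˡ-+ (suc n) (n C k) (n C suc k)) ⟨
  suc n C suc k + suc n * (n C k + n C suc k)
    ≡⟨ cong (λ z → suc n C suc k + suc n * z) (nCk+nC[k+1]≡[n+1]C[k+1] n k) ⟩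
  suc (suc n) * (suc n C suc k)  ∎
  where
  open ≡-Reasoning
  regroup : ∀ x y k → suc (suc k) * (x + y) ≡ x + suc k * x + suc (suc k) * y
  regroup = solve-∀

C-absorption-complement : ∀ b l → l ≤ b → (suc b C l) * suc (b ∸ l) ≡ suc b * (b C l)
C-absorption-complement b l l≤b = begin
  (suc b C l) * suc (b ∸ l)             ≡⟨ cong (_* suc (b ∸ l)) (nCk≡nC[n∸k] (m≤n⇒m≤1+n l≤b)) ⟩
  (suc b C (suc b ∸ l)) * suc (b ∸ l)   ≡⟨ cong (λ z → (suc b C z) * suc (b ∸ l)) (+-∸-assoc 1 l≤b) ⟩
  (suc b C suc (b ∸ l)) * suc (b ∸ l)   ≡⟨ *-comm (suc b C suc (b ∸ l)) _ ⟩
  suc (b ∸ l) * (suc b C suc (b ∸ l))   ≡⟨ C-absorption b (b ∸ l) ⟩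
  suc b * (b C (b ∸ l))                 ≡⟨ cong (suc b *_) (nCk≡nC[n∸k] l≤b) ⟨
  suc b * (b C l)                       ∎
  where open ≡-Reasoning

P-suc : ∀ m k → P (suc m) (suc k) ≡ P m (suc k) + suc k * P m k
P-suc m k = begin
  (suc m C suc k) * suc k !                 ≡⟨ cong (_* suc k !) (nCk+nC[k+1]≡[n+1]C[k+1] m k) ⟨
  (m C k + m C suc k) * (suc k * k !)       ≡⟨ regroup (m C k) (m C suc k) k (k !) ⟩
  (m C suc k) * suc k ! + suc k * ((m C k) * k !) ∎
  where
  open ≡-Reasoning
  regroup : ∀ x y k f → (x + y) * (suc k * f) ≡ y * (suc k * f) + suc k * (x * f)
  regroup = solve-∀

CP-suc : ∀ a b l → l ≤ suc b →
         (suc b C l) * P (suc a) (suc b ∸ l) ≡ suc b * ((b C l) * P a (b ∸ l)) + (suc b C l) * P a (suc b ∸ l)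
CP-suc a b l l≤1+b with m≤n⇒m<n∨m≡n l≤1+b
... | inj₂ refl rewrite n∸n≡0 b | k>n⇒nCk≡0 (n<1+n b) | *-zeroʳ b = refl
... | inj₁ (s≤s l≤b) = begin
  (suc b C l) * P (suc a) (suc b ∸ l)                             ≡⟨ cong (λ z → (suc b C l) * P (suc a) z) 1+b∸l≡1+k ⟩
  (suc b C l) * P (suc a) (suc k)                                 ≡⟨ cong ((suc b C l) *_) (P-suc a k) ⟩
  (suc b C l) * (P a (suc k) + suc k * P a k)                     ≡⟨ regroup (suc b C l) (P a (suc k)) k (P a k) ⟩
  (suc b C l) * suc k * P a k + (suc b C l) * P a (suc k)         ≡⟨ cong₂ (λ x y → x * P a k + (suc b C l) * P a y)
                                                                             (C-absorption-complement b l l≤b) (sym 1+b∸l≡1+k) ⟩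
  suc b * (b C l) * P a k + (suc b C l) * P a (suc b ∸ l)         ≡⟨ cong (_+ (suc b C l) * P a (suc b ∸ l)) (*-assoc (suc b) (b C l) (P a k)) ⟩
  suc b * ((b C l) * P a k) + (suc b C l) * P a (suc b ∸ l)       ∎
  where
  open ≡-Reasoning
  k = b ∸ l
  1+b∸l≡1+k : suc b ∸ l ≡ suc k
  1+b∸l≡1+k = +-∸-assoc 1 l≤b
  regroup : ∀ c x k y → c * (x + suc k * y) ≡ c * suc k * y + c * x
  regroup = solve-∀

-- Σ_{l ≤ b} C(b,l) P(a,b−l) t(l), the shape of the expansion B_a B_b = Σ_l C(b,l) P(a,b−l) B_{a+l}.
ΣCP : ℕ → ℕ → (ℕ → ℕ) → ℕ
ΣCP a b t = sumOf (λ l → (b C l) * P a (b ∸ l) * t l) (upTo (suc b))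

ΣCP-cong : ∀ a b {t t′ : ℕ → ℕ} → (∀ l → t l ≡ t′ l) → ΣCP a b t ≡ ΣCP a b t′
ΣCP-cong a b t≗t′ = sumOf-cong (upTo (suc b)) (λ l → cong ((b C l) * P a (b ∸ l) *_) (t≗t′ l))

ΣCP-zeroʳ : ∀ a t → ΣCP a 0 t ≡ t 0
ΣCP-zeroʳ a t = trans (+-identityʳ _) (*-identityˡ (t 0))

ΣCP-zeroˡ : ∀ b t → ΣCP 0 b t ≡ t b
ΣCP-zeroˡ b t = begin
  ΣCP 0 b t                                ≡⟨ sumOf-upTo-suc f b ⟩
  sumOf f (upTo b) + f b                   ≡⟨ cong₂ _+_ (sumOf-zero-upTo b f≡0) lastTerm ⟩
  t b                                      ∎
  where
  open ≡-Reasoning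
  f = λ l → (b C l) * P 0 (b ∸ l) * t l
  f≡0 : ∀ l → l < b → f l ≡ 0
  f≡0 l l<b = trans (cong (λ m → (b C l) * P 0 m * t l) (+-∸-assoc 1 l<b)) (cong (_* t l) (*-zeroʳ (b C l)))
  lastTerm : f b ≡ t b
  lastTerm = trans (cong (λ m → (b C b) * P 0 m * t b) (n∸n≡0 b))
                   (trans (cong (λ c → c * 1 * t b) (nCn≡1 b)) (+-identityʳ (t b)))

ΣCP-suc : ∀ a b t → ΣCP (suc a) (suc b) t ≡ suc b * ΣCP a b t + ΣCP a (suc b) t
ΣCP-suc a b t = begin
  ΣCP (suc a) (suc b) t
    ≡⟨ sumOf-cong-upTo (suc (suc b)) (λ l l< → cong (_* t l) (CP-suc a b l (≤-pred l<))) ⟩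
  sumOf (λ l → (suc b * c l + c′ l) * t l) (upTo (suc (suc b)))
    ≡⟨ sumOf-cong (upTo (suc (suc b))) (λ l → distrib (suc b) (c l) (c′ l) (t l)) ⟩
  sumOf (λ l → suc b * (c l * t l) + c′ l * t l) (upTo (suc (suc b)))
    ≡⟨ sumOf-+ (λ l → suc b * (c l * t l)) (λ l → c′ l * t l) (upTo (suc (suc b))) ⟩
  sumOf (λ l → suc b * (c l * t l)) (upTo (suc (suc b))) + ΣCP a (suc b) t
    ≡⟨ cong (_+ ΣCP a (suc b) t) (sumOf-*ˡ (suc b) (λ l → c l * t l) (upTo (suc (suc b)))) ⟩
  suc b * sumOf (λ l → c l * t l) (upTo (suc (suc b))) + ΣCP a (suc b) t
    ≡⟨ cong (λ z → suc b * z + ΣCP a (suc b) t) (sumOf-upTo-suc (λ l → c l * t l) (suc b)) ⟩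
  suc b * (ΣCP a b t + c (suc b) * t (suc b)) + ΣCP a (suc b) t
    ≡⟨ cong (λ z → suc b * (ΣCP a b t + z * P a (b ∸ suc b) * t (suc b)) + ΣCP a (suc b) t) (k>n⇒nCk≡0 (n<1+n b)) ⟩
  suc b * (ΣCP a b t + 0) + ΣCP a (suc b) t
    ≡⟨ cong (λ z → suc b * z + ΣCP a (suc b) t) (+-identityʳ (ΣCP a b t)) ⟩
  suc b * ΣCP a b t + ΣCP a (suc b) t  ∎
  where
  open ≡-Reasoning
  c  = λ l → (b C l) * P a (b ∸ l)
  c′ = λ l → (suc b C l) * P a (suc b ∸ l)
  distrib : ∀ s x y z → (s * x + y) * z ≡ s * (x * z) + y * z
  distrib = solve-∀

-- Composing reinsertions

module _ {A : Set} where

  concatMap-reinsert-map-∷ : ∀ b (c : A) L →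
    concatMap (reinsert (suc b)) (map (c ∷_) L) ≡ insertEach c (concatMap (reinsert b) L)
  concatMap-reinsert-map-∷ b c L =
    trans (concatMap-map (reinsert (suc b)) (c ∷_) L) (sym (concatMap-concatMap (insertions c) (reinsert b) L))

  sumOf-insertions-insertEach : ∀ (g : List A → ℕ) c x V →
    sumOf (λ v → sumOf g (insertions c v)) (insertEach x V) ≡ sumOf g (insertEach x (insertEach c V))
  sumOf-insertions-insertEach g c x V =
    trans (sym (sumOf-concatMap g (insertions c) (insertEach x V))) (sumOf-↭ g (insertEach-comm c x V))

  -- Split by whether x lies among the top b+1 letters (at one of b+1 positions) or below them.
  sumOf-reinsert-insertions : ∀ b (g : List A → ℕ) x u →
    sumOf g (concatMap (reinsert (suc b)) (insertions x u))
      ≡ suc b * sumOf g (insertEach x (reinsert b u)) + sumOf g (insertEach x (reinsert (suc b) u))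
  sumOf-reinsert-insertions zero    g x []      = sym (trans (+-identityʳ _) (*-identityˡ (g (x ∷ []) + 0)))
  sumOf-reinsert-insertions (suc b) g x []      = sym (trans (+-identityʳ _) (*-zeroʳ (suc (suc b))))
  sumOf-reinsert-insertions zero    g x (c ∷ u) = begin
    sumOf g (insertEach x (reinsert 0 (c ∷ u)) ++ concatMap (reinsert 1) (map (c ∷_) (insertions x u)))
      ≡⟨ sumOf-++ g (insertEach x (reinsert 0 (c ∷ u))) _ ⟩
    Q₀ + sumOf g (concatMap (reinsert 1) (map (c ∷_) (insertions x u)))
      ≡⟨ cong (Q₀ +_) (sumOf-↭ g moveX) ⟩
    Q₀ + Q₁
      ≡⟨ cong (_+ Q₁) (*-identityˡ Q₀) ⟨
    1 * Q₀ + Q₁  ∎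
    where
    open ≡-Reasoning
    Q₀ = sumOf g (insertEach x (reinsert 0 (c ∷ u)))
    Q₁ = sumOf g (insertEach x (reinsert 1 (c ∷ u)))
    moveX : concatMap (reinsert 1) (map (c ∷_) (insertions x u)) ↭ insertEach x (reinsert 1 (c ∷ u))
    moveX = ↭-trans (↭-reflexive (trans (concatMap-reinsert-map-∷ 0 c (insertions x u))
                                        (cong (insertEach c) (concatMap-pure (insertions x u)))))
                    (↭-trans (insertEach-insertions-comm c x u)
                             (↭-reflexive (cong (insertEach x) (sym (++-identityʳ (insertions c u))))))
  sumOf-reinsert-insertions (suc b) g x (c ∷ u) = begin
    sumOf g (insertEach x (reinsert (suc b) (c ∷ u)) ++ concatMap (reinsert (suc (suc b))) (map (c ∷_) (insertions x u)))
      ≡⟨ sumOf-++ g (insertEach x (reinsert (suc b) (c ∷ u))) _ ⟩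
    Q₁ + sumOf g (concatMap (reinsert (suc (suc b))) (map (c ∷_) (insertions x u)))
      ≡⟨ cong (λ L → Q₁ + sumOf g L) (concatMap-reinsert-map-∷ (suc b) c (insertions x u)) ⟩
    Q₁ + sumOf g (insertEach c (concatMap (reinsert (suc b)) (insertions x u)))
      ≡⟨ cong (Q₁ +_) (sumOf-concatMap g (insertions c) (concatMap (reinsert (suc b)) (insertions x u))) ⟩
    Q₁ + sumOf g′ (concatMap (reinsert (suc b)) (insertions x u))
      ≡⟨ cong (Q₁ +_) (sumOf-reinsert-insertions b g′ x u) ⟩
    Q₁ + (suc b * sumOf g′ (insertEach x (reinsert b u)) + sumOf g′ (insertEach x (reinsert (suc b) u)))
      ≡⟨ cong₂ (λ p q → Q₁ + (suc b * p + q)) (sumOf-insertions-insertEach g c x (reinsert b u))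
                                               (sumOf-insertions-insertEach g c x (reinsert (suc b) u)) ⟩
    Q₁ + (suc b * Q₁ + Q₂)
      ≡⟨ +-assoc Q₁ (suc b * Q₁) Q₂ ⟨
    suc (suc b) * Q₁ + Q₂  ∎
    where
    open ≡-Reasoning
    g′ = λ v → sumOf g (insertions c v)
    Q₁ = sumOf g (insertEach x (reinsert (suc b) (c ∷ u)))
    Q₂ = sumOf g (insertEach x (reinsert (suc (suc b)) (c ∷ u)))

  sumOf-reinsert-insertEach : ∀ b (g : List A → ℕ) x U →
    sumOf g (concatMap (reinsert (suc b)) (insertEach x U))
      ≡ suc b * sumOf (λ v → sumOf g (insertions x v)) (concatMap (reinsert b) U)
        + sumOf (λ v → sumOf g (insertions x v)) (concatMap (reinsert (suc b)) U)
  sumOf-reinsert-insertEach b g x U = begin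
    sumOf g (concatMap (reinsert (suc b)) (insertEach x U))
      ≡⟨ cong (sumOf g) (concatMap-concatMap (reinsert (suc b)) (insertions x) U) ⟩
    sumOf g (concatMap (λ u → concatMap (reinsert (suc b)) (insertions x u)) U)
      ≡⟨ sumOf-concatMap g _ U ⟩
    sumOf (λ u → sumOf g (concatMap (reinsert (suc b)) (insertions x u))) U
      ≡⟨ sumOf-cong U (sumOf-reinsert-insertions b g x) ⟩
    sumOf (λ u → suc b * h b u + h (suc b) u) U
      ≡⟨ sumOf-+ (λ u → suc b * h b u) (h (suc b)) U ⟩
    sumOf (λ u → suc b * h b u) U + sumOf (h (suc b)) U
      ≡⟨ cong (_+ sumOf (h (suc b)) U) (sumOf-*ˡ (suc b) (h b) U) ⟩
    suc b * sumOf (h b) U + sumOf (h (suc b)) U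
      ≡⟨ cong₂ (λ p q → suc b * p + q) (regroup b) (regroup (suc b)) ⟩
    suc b * sumOf g′ (concatMap (reinsert b) U) + sumOf g′ (concatMap (reinsert (suc b)) U)  ∎
    where
    open ≡-Reasoning
    g′ = λ v → sumOf g (insertions x v)
    h  = λ m u → sumOf g (insertEach x (reinsert m u))
    regroup : ∀ m → sumOf (h m) U ≡ sumOf g′ (concatMap (reinsert m) U)
    regroup m = trans (sumOf-cong U (λ u → sumOf-concatMap g (insertions x) (reinsert m u)))
                      (sym (sumOf-concatMap g′ (reinsert m) U))

  sumOf-reinsert-reinsert : ∀ a b (g : List A → ℕ) w →
    sumOf g (concatMap (reinsert b) (reinsert a w)) ≡ ΣCP a b (λ l → sumOf g (reinsert (a + l) w))
  sumOf-reinsert-reinsert a zero g w = begin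
    sumOf g (concatMap (reinsert 0) (reinsert a w))  ≡⟨ cong (sumOf g) (concatMap-pure (reinsert a w)) ⟩
    sumOf g (reinsert a w)                          ≡⟨ cong (λ m → sumOf g (reinsert m w)) (+-identityʳ a) ⟨
    sumOf g (reinsert (a + 0) w)                    ≡⟨ ΣCP-zeroʳ a (λ l → sumOf g (reinsert (a + l) w)) ⟨
    ΣCP a 0 (λ l → sumOf g (reinsert (a + l) w))   ∎
    where open ≡-Reasoning
  sumOf-reinsert-reinsert zero (suc b) g w =
    trans (cong (sumOf g) (++-identityʳ (reinsert (suc b) w))) (sym (ΣCP-zeroˡ (suc b) (λ l → sumOf g (reinsert l w))))
  sumOf-reinsert-reinsert (suc a) (suc b) g [] = sym (sumOf-zero (upTo (suc (suc b))) (λ l → *-zeroʳ ((suc b C l) * P (suc a) (suc b ∸ l))))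
  sumOf-reinsert-reinsert (suc a) (suc b) g (x ∷ w) = begin
    sumOf g (concatMap (reinsert (suc b)) (insertEach x (reinsert a w)))
      ≡⟨ sumOf-reinsert-insertEach b g x (reinsert a w) ⟩
    suc b * sumOf g′ (concatMap (reinsert b) (reinsert a w)) + sumOf g′ (concatMap (reinsert (suc b)) (reinsert a w))
      ≡⟨ cong₂ (λ p q → suc b * p + q) (sumOf-reinsert-reinsert a b g′ w) (sumOf-reinsert-reinsert a (suc b) g′ w) ⟩
    suc b * ΣCP a b t + ΣCP a (suc b) t
      ≡⟨ ΣCP-suc a b t ⟨
    ΣCP (suc a) (suc b) t
      ≡⟨ ΣCP-cong (suc a) (suc b) (λ l → sumOf-concatMap g (insertions x) (reinsert (a + l) w)) ⟨
    ΣCP (suc a) (suc b) (λ l → sumOf g (reinsert (suc a + l) (x ∷ w)))  ∎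
    where
    open ≡-Reasoning
    g′ = λ v → sumOf g (insertions x v)
    t  = λ l → sumOf g′ (reinsert (a + l) w)

module _ {A : Set} where

  stepAll : (ℕ → A → List A) → List A → ℕ → List A
  stepAll F U b = concatMap (F b) U

  foldl-stepAll : ∀ (F : ℕ → A → List A) as U →
                  foldl (stepAll F) U as ≡ concatMap (λ s → foldl (stepAll F) (s ∷ []) as) U
  foldl-stepAll F []       U = sym (concatMap-pure U)
  foldl-stepAll F (b ∷ as) U = begin
    foldl (stepAll F) (concatMap (F b) U) as
      ≡⟨ foldl-stepAll F as (concatMap (F b) U) ⟩
    concatMap fold₁ (concatMap (F b) U)
      ≡⟨ concatMap-concatMap fold₁ (F b) U ⟩
    concatMap (λ u → concatMap fold₁ (F b u)) U
      ≡⟨ concatMap-cong (λ u → trans (foldl-stepAll F as (F b u ++ []))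
                                     (cong (concatMap fold₁) (++-identityʳ (F b u)))) U ⟨
    concatMap (λ u → foldl (stepAll F) (F b u ++ []) as) U  ∎
    where
    open ≡-Reasoning
    fold₁ = λ s → foldl (stepAll F) (s ∷ []) as

  sumOf-foldl-stepAll : ∀ (F : ℕ → A → List A) as (g : A → ℕ) U →
    sumOf g (foldl (stepAll F) U as) ≡ sumOf (λ s → sumOf g (foldl (stepAll F) (s ∷ []) as)) U
  sumOf-foldl-stepAll F as g U = trans (cong (sumOf g) (foldl-stepAll F as U)) (sumOf-concatMap g _ U)

  foldl-stepAll-↭ : ∀ (F : ℕ → A → List A) as {U V} → U ↭ V → foldl (stepAll F) U as ↭ foldl (stepAll F) V as
  foldl-stepAll-↭ F as {U} {V} U↭V = begin
    foldl (stepAll F) U as                                 ≡⟨ foldl-stepAll F as U ⟩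
    concatMap (λ s → foldl (stepAll F) (s ∷ []) as) U      ↭⟨ concatMap⁺ _ U↭V ⟩
    concatMap (λ s → foldl (stepAll F) (s ∷ []) as) V      ≡⟨ foldl-stepAll F as V ⟨
    foldl (stepAll F) V as                                 ∎
    where open PermutationReasoning

cnt-[]-≢ : ∀ {m j} → m ≢ j → cnt m j [] ≡ 0
cnt-[]-≢ {m} {j} m≢j with m ≟ j
... | yes m≡j = contradiction m≡j m≢j
... | no  _   = refl

cnt-[]-refl : ∀ m → cnt m m [] ≡ 1
cnt-[]-refl m with m ≟ m
... | yes _   = refl
... | no  m≢m = contradiction refl m≢m

sumOf-cnt-[]-≥ : ∀ N m (f : ℕ → ℕ) → N ≤ m → sumOf (λ j → cnt m j [] * f j) (upTo N) ≡ 0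
sumOf-cnt-[]-≥ N m f N≤m =
  sumOf-zero-upTo N (λ j j<N → cong (_* f j) (cnt-[]-≢ (λ m≡j → <⇒≢ (<-≤-trans j<N N≤m) (sym m≡j))))

sumOf-cnt-[]-< : ∀ N m (f : ℕ → ℕ) → m < N → sumOf (λ j → cnt m j [] * f j) (upTo N) ≡ f m
sumOf-cnt-[]-< (suc N) m f m<1+N with m ≟ N
... | yes refl = trans (sumOf-upTo-suc _ N) (cong₂ _+_ (sumOf-cnt-[]-≥ N N f ≤-refl) (trans (cong (_* f N) (cnt-[]-refl N)) (*-identityˡ (f N))))
... | no  m≢N  = trans (sumOf-upTo-suc _ N)
                       (trans (cong₂ _+_ (sumOf-cnt-[]-< N m f (≤∧≢⇒< (≤-pred m<1+N) m≢N)) (cong (_* f N) (cnt-[]-≢ m≢N)))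
                              (+-identityʳ (f m)))

module _ {A : Set} where

  sumOf-foldl-reinsert : ∀ as m (g : List A → ℕ) w →
    sumOf g (foldl (stepAll reinsert) (reinsert m w) as)
      ≡ sumOf (λ j → cnt m j as * sumOf g (reinsert j w)) (upTo (suc (length w)))
  sumOf-foldl-reinsert [] m g w with m ≤? length w
  ... | yes m≤∣w∣ = sym (sumOf-cnt-[]-< (suc (length w)) m (λ j → sumOf g (reinsert j w)) (s≤s m≤∣w∣))
  ... | no  m≰∣w∣ = trans (cong (sumOf g) (reinsert-tooShort m w (≰⇒> m≰∣w∣)))
                          (sym (sumOf-cnt-[]-≥ (suc (length w)) m (λ j → sumOf g (reinsert j w)) (≰⇒> m≰∣w∣)))
  sumOf-foldl-reinsert (b ∷ as) m g w = begin
    sumOf g (foldl (stepAll reinsert) (concatMap (reinsert b) (reinsert m w)) as)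
      ≡⟨ sumOf-foldl-stepAll reinsert as g _ ⟩
    sumOf h (concatMap (reinsert b) (reinsert m w))
      ≡⟨ sumOf-reinsert-reinsert m b h w ⟩
    ΣCP m b (λ l → sumOf h (reinsert (m + l) w))
      ≡⟨ ΣCP-cong m b (λ l → trans (sym (sumOf-foldl-stepAll reinsert as g (reinsert (m + l) w)))
                                   (sumOf-foldl-reinsert as (m + l) g w)) ⟩
    ΣCP m b (λ l → sumOf (λ j → cnt (m + l) j as * t j) (upTo (suc (length w))))
      ≡⟨ sumOf-*-sumOf-comm (λ l → (b C l) * P m (b ∸ l)) (λ l j → cnt (m + l) j as) t (upTo (suc b)) (upTo (suc (length w))) ⟩
    sumOf (λ j → cnt m j (b ∷ as) * t j) (upTo (suc (length w)))  ∎
    where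
    open ≡-Reasoning
    h = λ s → sumOf g (foldl (stepAll reinsert) (s ∷ []) as)
    t = λ j → sumOf g (reinsert j w)

*-annihilatedʳ : ∀ c {x} → x ≡ 0 → c * x ≡ 0
*-annihilatedʳ c x≡0 = trans (cong (c *_) x≡0) (*-zeroʳ c)

j<m⇒cnt≡0 : ∀ as {m j} → j < m → cnt m j as ≡ 0
j<m⇒cnt≡0 []            j<m = cnt-[]-≢ (λ m≡j → <⇒≢ j<m (sym m≡j))
j<m⇒cnt≡0 (b ∷ as) {m} j<m = sumOf-zero (upTo (suc b)) λ l →
  *-annihilatedʳ ((b C l) * P m (b ∸ l)) (j<m⇒cnt≡0 as (<-≤-trans j<m (m≤m+n m l)))

-- When m + l ≤ j < b there are fewer nonempty bins than remaining letters of the segment: P(m, b − l) = 0.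
j<maxL⇒cnt≡0 : ∀ as {m j} → j < maxL as → cnt m j as ≡ 0
j<maxL⇒cnt≡0 (b ∷ as) {m} {j} j<b⊔max with ⊔-sel b (maxL as)
... | inj₂ b⊔max≡max = sumOf-zero (upTo (suc b)) λ l →
  *-annihilatedʳ ((b C l) * P m (b ∸ l)) (j<maxL⇒cnt≡0 as (subst (j <_) b⊔max≡max j<b⊔max))
... | inj₁ b⊔max≡b = sumOf-zero (upTo (suc b)) term≡0
  where
  j<b : j < b
  j<b = subst (j <_) b⊔max≡b j<b⊔max
  term≡0 : ∀ l → (b C l) * P m (b ∸ l) * cnt (m + l) j as ≡ 0
  term≡0 l with m + l ≤? j
  ... | no  m+l≰j = *-annihilatedʳ ((b C l) * P m (b ∸ l)) (j<m⇒cnt≡0 as (≰⇒> m+l≰j))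
  ... | yes m+l≤j = cong (_* cnt (m + l) j as) (*-annihilatedʳ (b C l) (cong (_* (b ∸ l) !) (k>n⇒nCk≡0 m<b∸l)))
    where
    m<b∸l : m < b ∸ l
    m<b∸l = subst (_< b ∸ l) (m+n∸n≡m m l) (∸-monoˡ-< (≤-<-trans m+l≤j j<b) (m≤n+m l m))

m+sum<j⇒cnt≡0 : ∀ as {m j} → m + sumℕ as < j → cnt m j as ≡ 0
m+sum<j⇒cnt≡0 []            m+0<j = cnt-[]-≢ (λ m≡j → <⇒≢ (≤-<-trans (m≤m+n _ 0) m+0<j) m≡j)
m+sum<j⇒cnt≡0 (b ∷ as) {m} m+sum<j = sumOf-zero-upTo (suc b) λ l l<1+b →
  *-annihilatedʳ ((b C l) * P m (b ∸ l)) (m+sum<j⇒cnt≡0 as (≤-<-trans (bound l (≤-pred l<1+b)) m+sum<j))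
  where
  bound : ∀ l → l ≤ b → m + l + sumℕ as ≤ m + (b + sumℕ as)
  bound l l≤b = ≤-trans (+-monoˡ-≤ (sumℕ as) (+-monoʳ-≤ m l≤b)) (≤-reflexive (+-assoc m b (sumℕ as)))

Qcard≡0-outside : ∀ j a₁ as → j < maxL (a₁ ∷ as) ⊎ sumℕ (a₁ ∷ as) < j → Qcard j a₁ as ≡ 0
Qcard≡0-outside j a₁ as (inj₂ a₁+sum<j) = m+sum<j⇒cnt≡0 as a₁+sum<j
Qcard≡0-outside j a₁ as (inj₁ j<a₁⊔max) with ⊔-sel a₁ (maxL as)
... | inj₁ a₁⊔max≡a₁  = j<m⇒cnt≡0 as (subst (j <_) a₁⊔max≡a₁ j<a₁⊔max)
... | inj₂ a₁⊔max≡max = j<maxL⇒cnt≡0 as (subst (j <_) a₁⊔max≡max j<a₁⊔max)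

maxL≤sumℕ : ∀ xs → maxL xs ≤ sumℕ xs
maxL≤sumℕ []       = z≤n
maxL≤sumℕ (x ∷ xs) = ⊔-lub (m≤m+n x (sumℕ xs)) (≤-trans (maxL≤sumℕ xs) (m≤n+m (sumℕ xs) x))

maxL≤ : ∀ {n xs} → All (_≤ n) xs → maxL xs ≤ n
maxL≤ []           = z≤n
maxL≤ (x≤n ∷ xs≤n) = ⊔-lub x≤n (maxL≤ xs≤n)

-- The group algebra

toℚ : ℕ → ℚ
toℚ k = ℤ.+ k / 1

toℚ-mkℚ : ∀ k → toℚ k ≡ mkℚ (ℤ.+ k) 0 (Coprime-sym (1-coprimeTo k))
toℚ-mkℚ k = ℚₚ.normalize-coprime (Coprime-sym (1-coprimeTo k))

toℚ-+ : ∀ a b → toℚ (a + b) ≡ toℚ a ℚ.+ toℚ b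
toℚ-+ a b = sym (trans (cong₂ ℚ._+_ (toℚ-mkℚ a) (toℚ-mkℚ b))
                       (cong (_/ 1) (cong₂ ℤ._+_ (ℤₚ.*-identityʳ (ℤ.+ a)) (ℤₚ.*-identityʳ (ℤ.+ b)))))

toℚ-* : ∀ a b → toℚ (a * b) ≡ toℚ a ℚ.* toℚ b
toℚ-* a b = sym (trans (cong₂ ℚ._*_ (toℚ-mkℚ a) (toℚ-mkℚ b)) (cong (_/ 1) (ℤₚ.+◃n≡+n (a * b))))

tabulate-at : ∀ {A : Set} {m} (s : List A) (default : Fin m → A) → length s ≡ m →
              tabulate (λ i → at s (toℕ i) (default i)) ≡ s
tabulate-at {m = zero}  []      _       _     = refl
tabulate-at {m = suc m} (x ∷ s) default ∣s∣≡m = cong (x ∷_) (tabulate-at s (λ i → default (Fin.suc i)) (suc-injective ∣s∣≡m))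

module _ {n : ℕ} where

  formalSum : List (Deck n) → QS n
  formalSum = map (1ℚ ,_)

  Bdecks : ℕ → List (Deck n)
  Bdecks a = concatMap (λ α → shuffle α (W a n)) (orderings (take a (allFin n)))

  rightMulBdecks : ℕ → Deck n → List (Deck n)
  rightMulBdecks b s = map (s ∘ᵈ_) (Bdecks b)

  Σ-QS-formalSum : ∀ {C : Set} (f : C → List (Deck n)) ys → Σ-QS (map (λ y → formalSum (f y)) ys) ≡ formalSum (concatMap f ys)
  Σ-QS-formalSum f []       = refl
  Σ-QS-formalSum f (y ∷ ys) = trans (cong (formalSum (f y) ++_) (Σ-QS-formalSum f ys)) (sym (map-++ (1ℚ ,_) (f y) (concatMap f ys)))

  B≡formalSum : ∀ a → B n a ≡ formalSum (Bdecks a)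
  B≡formalSum a = trans (cong Σ-QS (map-cong (λ α → trans (Σ-QS-formalSum (_∷ []) (shuffle α (W a n))) (cong formalSum (concatMap-pure _)))
                                          (orderings (take a (allFin n)))))
                    (Σ-QS-formalSum (λ α → shuffle α (W a n)) (orderings (take a (allFin n))))

  formalSum-· : ∀ (U V : List (Deck n)) → formalSum U · formalSum V ≡ formalSum (concatMap (λ s → map (s ∘ᵈ_) V) U)
  formalSum-· []      V = refl
  formalSum-· (s ∷ U) V =
    trans (cong₂ _++_ (trans (sym (map-∘ V)) (map-∘ {g = 1ℚ ,_} {f = s ∘ᵈ_} V)) (formalSum-· U V))
          (sym (map-++ (1ℚ ,_) (map (s ∘ᵈ_) V) (concatMap (λ s → map (s ∘ᵈ_) V) U)))

  foldl-·B≡formalSum : ∀ as U → foldl (λ acc a → acc · B n a) (formalSum U) as ≡ formalSum (foldl (stepAll rightMulBdecks) U as)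
  foldl-·B≡formalSum []       U = refl
  foldl-·B≡formalSum (b ∷ as) U =
    trans (cong (λ x → foldl (λ acc a → acc · B n a) x as) (trans (cong (formalSum U ·_) (B≡formalSum b)) (formalSum-· U (Bdecks b))))
          (foldl-·B≡formalSum as _)

  indicator : Deck n → Deck n → ℕ
  indicator d s with ≡-dec Fin._≟_ s d
  ... | yes _ = 1
  ... | no  _ = 0

  coeff-formalSum : ∀ U d → coeff (formalSum U) d ≡ toℚ (sumOf (indicator d) U)
  coeff-formalSum []      d = refl
  coeff-formalSum (s ∷ U) d with ≡-dec Fin._≟_ s d
  ... | yes _ = trans (cong (1ℚ ℚ.+_) (coeff-formalSum U d)) (sym (toℚ-+ 1 (sumOf (indicator d) U)))
  ... | no  _ = coeff-formalSum U d

  coeff-++ : ∀ (x y : QS n) d → coeff (x ++ y) d ≡ coeff x d ℚ.+ coeff y d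
  coeff-++ []            y d = sym (ℚₚ.+-identityˡ _)
  coeff-++ ((q , s) ∷ x) y d with ≡-dec Fin._≟_ s d
  ... | yes _ = trans (cong (q ℚ.+_) (coeff-++ x y d)) (sym (ℚₚ.+-assoc q _ _))
  ... | no  _ = coeff-++ x y d

  coeff-⊛ : ∀ k (x : QS n) d → coeff (k ⊛ x) d ≡ toℚ k ℚ.* coeff x d
  coeff-⊛ k []            d = sym (ℚₚ.*-zeroʳ (toℚ k))
  coeff-⊛ k ((q , s) ∷ x) d with ≡-dec Fin._≟_ s d
  ... | yes _ = trans (cong (toℚ k ℚ.* q ℚ.+_) (coeff-⊛ k x d)) (sym (ℚₚ.*-distribˡ-+ (toℚ k) q _))
  ... | no  _ = coeff-⊛ k x d

  coeff-Σ-⊛B : ∀ (c : ℕ → ℕ) js d →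
    coeff (Σ-QS (map (λ j → c j ⊛ B n j) js)) d ≡ toℚ (sumOf (λ j → c j * sumOf (indicator d) (Bdecks j)) js)
  coeff-Σ-⊛B c []       d = refl
  coeff-Σ-⊛B c (j ∷ js) d = begin
    coeff (c j ⊛ B n j ++ Σ-QS (map (λ j → c j ⊛ B n j) js)) d
      ≡⟨ coeff-++ (c j ⊛ B n j) _ d ⟩
    coeff (c j ⊛ B n j) d ℚ.+ coeff (Σ-QS (map (λ j → c j ⊛ B n j) js)) d
      ≡⟨ cong₂ ℚ._+_ (trans (coeff-⊛ (c j) (B n j) d) (cong (λ x → toℚ (c j) ℚ.* coeff x d) (B≡formalSum j))) (coeff-Σ-⊛B c js d) ⟩
    toℚ (c j) ℚ.* coeff (formalSum (Bdecks j)) d ℚ.+ toℚ (sumOf f js)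
      ≡⟨ cong (λ q → toℚ (c j) ℚ.* q ℚ.+ toℚ (sumOf f js)) (coeff-formalSum (Bdecks j) d) ⟩
    toℚ (c j) ℚ.* toℚ (sumOf (indicator d) (Bdecks j)) ℚ.+ toℚ (sumOf f js)
      ≡⟨ cong (ℚ._+ toℚ (sumOf f js)) (toℚ-* (c j) _) ⟨
    toℚ (f j) ℚ.+ toℚ (sumOf f js)
      ≡⟨ toℚ-+ (f j) (sumOf f js) ⟨
    toℚ (sumOf f (j ∷ js))  ∎
    where
    open ≡-Reasoning
    f = λ j → c j * sumOf (indicator d) (Bdecks j)

  ∘ᵈ-identityʳ : ∀ (s : Deck n) → length s ≡ n → s ∘ᵈ allFin n ≡ s
  ∘ᵈ-identityʳ s ∣s∣≡n = trans (map-tabulate (λ i → i) (λ c → at s (toℕ c) c)) (tabulate-at s (λ i → i) ∣s∣≡n)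

  Bdecks↭reinsert : ∀ {b} → b ≤ n → Bdecks b ↭ reinsert b (allFin n)
  Bdecks↭reinsert {b} b≤n = orderings-shuffle-take-drop b (allFin n) (subst (b ≤_) (sym (length-tabulate {n = n} (λ i → i))) b≤n)

  rightMulBdecks↭reinsert : ∀ {b} (s : Deck n) → b ≤ n → length s ≡ n → rightMulBdecks b s ↭ reinsert b s
  rightMulBdecks↭reinsert {b} s b≤n ∣s∣≡n = begin
    map (s ∘ᵈ_) (Bdecks b)                       ↭⟨ ↭.map⁺ (s ∘ᵈ_) (Bdecks↭reinsert b≤n) ⟩
    map (map (λ c → at s (toℕ c) c)) (reinsert b (allFin n)) ≡⟨ map-reinsert (λ c → at s (toℕ c) c) b (allFin n) ⟩
    reinsert b (s ∘ᵈ allFin n)                   ≡⟨ cong (reinsert b) (∘ᵈ-identityʳ s ∣s∣≡n) ⟩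
    reinsert b s                                 ∎
    where open PermutationReasoning

  foldl-rightMulBdecks↭ : ∀ as {U} → All (_≤ n) as → All (λ s → length s ≡ n) U →
    foldl (stepAll rightMulBdecks) U as ↭ foldl (stepAll reinsert) U as
  foldl-rightMulBdecks↭ []       _             _    = ↭-refl
  foldl-rightMulBdecks↭ (b ∷ as) {U} (b≤n ∷ as≤n) ∣U∣≡n =
    ↭-trans (foldl-stepAll-↭ rightMulBdecks as (concatMap-↭ (All.map (λ {s} → rightMulBdecks↭reinsert s b≤n) ∣U∣≡n)))
            (foldl-rightMulBdecks↭ as as≤n
              (All.concat⁺ (All.map⁺ (All.map (λ ∣s∣≡n → All.map (λ e → trans e ∣s∣≡n) (reinsert-length b _)) ∣U∣≡n))))

  length-allFin : length (allFin n) ≡ n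
  length-allFin = length-tabulate (λ i → i)

  count-Bprod : ∀ a₁ as → All (_≤ n) (a₁ ∷ as) → ∀ d →
    sumOf (indicator d) (foldl (stepAll rightMulBdecks) (Bdecks a₁) as)
      ≡ sumOf (λ j → Qcard j a₁ as * sumOf (indicator d) (Bdecks j)) (range (maxL (a₁ ∷ as)) (sumℕ (a₁ ∷ as) ⊓ n))
  count-Bprod a₁ as all≤n@(a₁≤n ∷ as≤n) d = begin
    sumOf (indicator d) (foldl (stepAll rightMulBdecks) (Bdecks a₁) as)
      ≡⟨ sumOf-↭ (indicator d) (↭-trans (foldl-stepAll-↭ rightMulBdecks as (Bdecks↭reinsert a₁≤n))
                                        (foldl-rightMulBdecks↭ as as≤n ∣reinsert∣≡n)) ⟩
    sumOf (indicator d) (foldl (stepAll reinsert) (reinsert a₁ (allFin n)) as)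
      ≡⟨ sumOf-foldl-reinsert as a₁ (indicator d) (allFin n) ⟩
    sumOf f (upTo (suc (length (allFin n))))
      ≡⟨ sumOf-upTo-range f _ lo hi lo≤hi (s≤s (subst (hi ≤_) (sym length-allFin) (m⊓n≤n _ n))) below above ⟩
    sumOf f (range lo hi)
      ≡⟨ sumOf-cong-range lo hi lo≤hi (λ j j≤hi → cong (Qcard j a₁ as *_)
           (sumOf-↭ (indicator d) (↭-sym (Bdecks↭reinsert (≤-trans j≤hi (m⊓n≤n _ n)))))) ⟩
    sumOf (λ j → Qcard j a₁ as * sumOf (indicator d) (Bdecks j)) (range lo hi)  ∎
    where
    open ≡-Reasoning
    lo = maxL (a₁ ∷ as)
    hi = sumℕ (a₁ ∷ as) ⊓ n
    f  = λ j → Qcard j a₁ as * sumOf (indicator d) (reinsert j (allFin n))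
    ∣reinsert∣≡n : All (λ s → length s ≡ n) (reinsert a₁ (allFin n))
    ∣reinsert∣≡n = All.map (λ e → trans e length-allFin) (reinsert-length a₁ (allFin n))
    lo≤hi : lo ≤ hi
    lo≤hi = ⊓-glb (maxL≤sumℕ (a₁ ∷ as)) (maxL≤ all≤n)
    below : ∀ j → j < lo → f j ≡ 0
    below j j<lo = cong (_* _) (Qcard≡0-outside j a₁ as (inj₁ j<lo))
    above : ∀ j → hi < j → f j ≡ 0
    above j hi<j with ⊓-sel (sumℕ (a₁ ∷ as)) n
    ... | inj₁ hi≡sum = cong (_* _) (Qcard≡0-outside j a₁ as (inj₂ (subst (_< j) hi≡sum hi<j)))
    ... | inj₂ hi≡n   = *-annihilatedʳ (Qcard j a₁ as)
                          (cong (sumOf (indicator d)) (reinsert-tooShort j (allFin n) (subst (_< j) (trans hi≡n (sym length-allFin)) hi<j)))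

theorem3p2 : (n a₁ : ℕ) (as : List ℕ) →
  All (λ a → 1 ≤ a × a ≤ n) (a₁ ∷ as) →
  Bprod n a₁ as ≈
    Σ-QS (map (λ j → Qcard j a₁ as ⊛ B n j)
              (range (maxL (a₁ ∷ as)) (sumℕ (a₁ ∷ as) ⊓ n)))
theorem3p2 n a₁ as bounds d = begin
  coeff (Bprod n a₁ as) d
    ≡⟨ cong (λ x → coeff (foldl (λ acc a → acc · B n a) x as) d) (B≡formalSum a₁) ⟩
  coeff (foldl (λ acc a → acc · B n a) (formalSum (Bdecks a₁)) as) d
    ≡⟨ cong (λ x → coeff x d) (foldl-·B≡formalSum as (Bdecks a₁)) ⟩
  coeff (formalSum (foldl (stepAll rightMulBdecks) (Bdecks a₁) as)) d
    ≡⟨ coeff-formalSum (foldl (stepAll rightMulBdecks) (Bdecks a₁) as) d ⟩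
  toℚ (sumOf (indicator d) (foldl (stepAll rightMulBdecks) (Bdecks a₁) as))
    ≡⟨ cong toℚ (count-Bprod a₁ as (All.map proj₂ bounds) d) ⟩
  toℚ (sumOf (λ j → Qcard j a₁ as * sumOf (indicator d) (Bdecks j)) (range (maxL (a₁ ∷ as)) (sumℕ (a₁ ∷ as) ⊓ n)))
    ≡⟨ coeff-Σ-⊛B (λ j → Qcard j a₁ as) (range (maxL (a₁ ∷ as)) (sumℕ (a₁ ∷ as) ⊓ n)) d ⟨
  coeff (Σ-QS (map (λ j → Qcard j a₁ as ⊛ B n j) (range (maxL (a₁ ∷ as)) (sumℕ (a₁ ∷ as) ⊓ n)))) d  ∎
  where open ≡-Reasoning
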